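{- Let $X$ be a unicyclic bipartite graph with a unique perfect matching. If $X$ has more than two pegs, then between any two vertices of $X$ there is at most one co-augmenting path.
   Context: A unicyclic graph is a connected graph containing exactly one cycle. Let $\mathcal{M}$ be the unique perfect matching. A peg is an edge of $\mathcal{M}$ that is not an edge of the cycle but is incident to a vertex of the cycle. A path is co-augmenting if its edges alternate between edges of $\mathcal{M}$ and edges not in $\mathcal{M}$, with the first and last edges in $\mathcal{M}$. (The same applies to mixed graphs via their underlying graphs.) -}

module Defs where

open import Data.Nat using (ℕ; _≤_)
open import Data.Fin using (Fin)
open import Data.Bool using (Bool; true; false)
open import Data.List using (List; []; _∷_; _++_; [_]; length; zip; head; last)
open import Data.List.Relation.Unary.All using (All)
open import Data.List.Relation.Unary.Linked using (Linked)
open import Data.List.Relation.Unary.Unique.Propositional using (Unique)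
open import Data.List.Membership.Propositional using (_∈_)
open import Data.Maybe using (just)
open import Data.Product using (Σ; _×_; _,_; ∃)
open import Data.Sum using (_⊎_)
open import Data.Unit using (⊤)
open import Data.Empty using (⊥)
open import Relation.Binary.PropositionalEquality using (_≡_; _≢_)
open import Relation.Nullary using (¬_)
open import Function.Bundles using (_⇔_)

record Graph : Set where
  field
    n      : ℕ
    adj    : Fin n → Fin n → Bool
    sym    : ∀ u v → adj u v ≡ adj v u
    irrefl : ∀ v → adj v v ≡ false

module _ (G : Graph) where
  open Graph G

  Adj : Fin n → Fin n → Set
  Adj u v = adj u v ≡ true

  IsWalk : Fin n → Fin n → List (Fin n) → Set
  IsWalk x y ws = (head ws ≡ just x) × (last ws ≡ just y) × Linked Adj ws

  IsPath : Fin n → Fin n → List (Fin n) → Set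
  IsPath x y ps = IsWalk x y ps × Unique ps

  Connected : Set
  Connected = ∀ u v → ∃ λ ws → IsWalk u v ws

  rotate : List (Fin n) → List (Fin n)
  rotate []       = []
  rotate (x ∷ xs) = xs ++ [ x ]

  -- a cycle v0 v1 … v(k-1) v0, given by its k ≥ 3 distinct vertices
  IsCycle : List (Fin n) → Set
  IsCycle cs = (3 ≤ length cs) × Unique cs
             × All (λ p → Adj (Data.Product.proj₁ p) (Data.Product.proj₂ p)) (zip cs (rotate cs))

  CycleEdge : List (Fin n) → Fin n → Fin n → Set
  CycleEdge cs u v = ((u , v) ∈ zip cs (rotate cs)) ⊎ ((v , u) ∈ zip cs (rotate cs))

  -- two cycles are the same cycle iff they have the same edge set
  SameCycle : List (Fin n) → List (Fin n) → Set
  SameCycle c c' = ∀ u v → CycleEdge c u v ⇔ CycleEdge c' u v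

  Unicyclic : Set
  Unicyclic = Connected × (Σ (List (Fin n)) λ c → IsCycle c × (∀ c' → IsCycle c' → SameCycle c c'))

  Bipartite : Set
  Bipartite = Σ (Fin n → Bool) λ col → ∀ u v → Adj u v → col u ≢ col v

  -- a perfect matching, given by the partner function m: every vertex v is
  -- matched to m v via an edge, and the matching edges are {v , m v}
  IsPerfectMatching : (Fin n → Fin n) → Set
  IsPerfectMatching m = ∀ v → Adj v (m v) × m (m v) ≡ v

  UniquePerfectMatching : (Fin n → Fin n) → Set
  UniquePerfectMatching m = IsPerfectMatching m × (∀ m' → IsPerfectMatching m' → ∀ v → m' v ≡ m v)

  module _ (m : Fin n → Fin n) where
    -- alternation along a vertex list: AltM starts with a matching edge,
    -- AltN starts with a non-matching edge (or the list ends here, after a matching edge)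
    AltM AltN : List (Fin n) → Set
    AltM []            = ⊥
    AltM (_ ∷ [])      = ⊥
    AltM (u ∷ v ∷ rs)  = (v ≡ m u) × AltN (v ∷ rs)
    AltN []            = ⊥
    AltN (_ ∷ [])      = ⊤
    AltN (u ∷ v ∷ rs)  = (v ≢ m u) × AltM (v ∷ rs)

    -- co-augmenting path from x to y: a path alternating between matching and
    -- non-matching edges, first and last edge in the matching
    CoAugmenting : Fin n → Fin n → List (Fin n) → Set
    CoAugmenting x y ps = IsPath x y ps × AltM ps

    -- a peg: a matching edge {v , m v} with v on the cycle c that is not a cycle edge
    IsPegAt : List (Fin n) → Fin n → Set
    IsPegAt c v = (v ∈ c) × ¬ CycleEdge c v (m v)

    -- more than two pegs: three pairwise distinct pegs (edges {a,m a}, {b,m b}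
    -- are distinct iff b ≢ a and b ≢ m a)
    DistinctEdges : Fin n → Fin n → Set
    DistinctEdges a b = (b ≢ a) × (b ≢ m a)

    MoreThanTwoPegs : List (Fin n) → Set
    MoreThanTwoPegs c = Σ (Fin n) λ a → Σ (Fin n) λ b → Σ (Fin n) λ d →
      IsPegAt c a × IsPegAt c b × IsPegAt c d ×
      DistinctEdges a b × DistinctEdges a d × DistinctEdges b d

-- Suppose p ≢ q. Walking from x, the two paths agree up to a vertex where they fork; let merge be
-- the first later vertex of p that also lies on q. The two branches from fork to merge are
-- internally disjoint and close up to a cycle, which by unicyclicity is the cycle of the graph.
-- An alternating path matches each of its interior vertices to a neighbour on the path, so every
-- vertex of this cycle other than fork and merge is matched along a cycle edge. Hence pegs can
-- only sit at fork and merge, and there cannot be three of them.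
module Submission where

open import Defs
open import Data.Fin using (Fin)
open import Data.List using (List)
open import Relation.Binary.PropositionalEquality using (_≡_)

open import Data.Bool using (Bool; true; false; not)
open import Data.Empty using (⊥; ⊥-elim)
open import Data.Fin using (_≟_)
open import Data.List using ([]; _∷_; _++_; [_]; length; reverse; zip; head; last)
open import Data.List.Properties
  using (++-assoc; length-++; length-reverse; unfold-reverse; reverse-++; reverse-involutive; ≡-dec)
open import Data.List.Membership.Propositional using (_∈_)
open import Data.List.Membership.Propositional.Properties using (∈-++⁺ˡ; ∈-++⁺ʳ; ∈-++⁻; ∈-∃++)
open import Data.List.Relation.Binary.Disjoint.Propositional using (Disjoint)
import Data.List.Relation.Binary.Permutation.Setoid as Permutation
import Data.List.Relation.Binary.Permutation.Setoid.Properties as Permutation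
open import Data.List.Relation.Unary.All as All using (All)
import Data.List.Relation.Unary.All.Properties as All
open import Data.List.Relation.Unary.AllPairs using ([]; _∷_)
open import Data.List.Relation.Unary.Any using (here; there)
open import Data.List.Relation.Unary.Any.Properties using (reverse⁻)
open import Data.List.Relation.Unary.Linked using (Linked; [-]; _∷_)
open import Data.List.Relation.Unary.Unique.Propositional using (Unique)
open import Data.List.Relation.Unary.Unique.Propositional.Properties using (Unique[x∷xs]⇒x∉xs)
import Data.List.Relation.Unary.Unique.Propositional.Properties as Unique
open import Data.Maybe using (just)
open import Data.Nat using (suc; _≤_; _+_; z≤n; s≤s)
open import Data.Nat.Properties using (+-suc)
open import Data.Product using (Σ; ∃; _×_; _,_; proj₂)
import Data.Product as Product
open import Data.Sum using (_⊎_; inj₁; inj₂)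
import Data.Sum as Sum
open import Function using (_∘_)
open import Function.Bundles using (Equivalence)
import Function.Properties.Equivalence as ⇔
open import Relation.Binary.Definitions using (DecidableEquality)
open import Relation.Binary.PropositionalEquality
  using (refl; sym; trans; cong; subst; _≢_; module ≡-Reasoning)
open import Relation.Binary.PropositionalEquality.Properties using (setoid)
open import Relation.Nullary using (yes; no)

open ≡-Reasoning

private
  variable
    A : Set

pairs : List A → List (A × A)
pairs []          = []
pairs (_ ∷ [])    = []
pairs (x ∷ y ∷ r) = (x , y) ∷ pairs (y ∷ r)

Neighbours : List A → A → A → Set
Neighbours xs u w = (u , w) ∈ pairs xs ⊎ (w , u) ∈ pairs xs

zip-∷-∷ʳ : ∀ (x : A) xs y → zip (x ∷ xs) (xs ++ [ y ]) ≡ pairs (x ∷ xs ++ [ y ])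
zip-∷-∷ʳ x []       y = refl
zip-∷-∷ʳ x (z ∷ xs) y = cong ((x , z) ∷_) (zip-∷-∷ʳ z xs y)

pairs-++-∷ : ∀ xs (y : A) ys → pairs (xs ++ y ∷ ys) ≡ pairs (xs ++ [ y ]) ++ pairs (y ∷ ys)
pairs-++-∷ []           y ys = refl
pairs-++-∷ (x ∷ [])     y ys = refl
pairs-++-∷ (x ∷ z ∷ xs) y ys = cong ((x , z) ∷_) (pairs-++-∷ (z ∷ xs) y ys)

∈-pairs-∷ : ∀ {e} (x : A) xs → e ∈ pairs xs → e ∈ pairs (x ∷ xs)
∈-pairs-∷ x (_ ∷ _) e∈xs = there e∈xs

∈-pairs-++⁺ˡ : ∀ {e} xs (ys : List A) → e ∈ pairs xs → e ∈ pairs (xs ++ ys)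
∈-pairs-++⁺ˡ (x ∷ y ∷ xs) ys (here e≡xy)  = here e≡xy
∈-pairs-++⁺ˡ (x ∷ y ∷ xs) ys (there e∈xs) = there (∈-pairs-++⁺ˡ (y ∷ xs) ys e∈xs)

∈-pairs-++⁺ʳ : ∀ {e} (xs ys : List A) → e ∈ pairs ys → e ∈ pairs (xs ++ ys)
∈-pairs-++⁺ʳ []       ys e∈ys = e∈ys
∈-pairs-++⁺ʳ (x ∷ xs) ys e∈ys = ∈-pairs-∷ x (xs ++ ys) (∈-pairs-++⁺ʳ xs ys e∈ys)

∈-pairs-infix : ∀ {e} xs ys (zs : List A) → e ∈ pairs ys → e ∈ pairs (xs ++ ys ++ zs)
∈-pairs-infix xs ys zs = ∈-pairs-++⁺ʳ xs (ys ++ zs) ∘ ∈-pairs-++⁺ˡ ys zs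

∈-pairs-∷ʳ-∷ʳ : ∀ zs (y x : A) → (y , x) ∈ pairs ((zs ++ [ y ]) ++ [ x ])
∈-pairs-∷ʳ-∷ʳ []       y x = here refl
∈-pairs-∷ʳ-∷ʳ (z ∷ zs) y x = ∈-pairs-∷ z _ (∈-pairs-∷ʳ-∷ʳ zs y x)

∈-pairs-reverse : ∀ xs {u w : A} → (u , w) ∈ pairs xs → (w , u) ∈ pairs (reverse xs)
∈-pairs-reverse (x ∷ y ∷ xs) {u} {w} uw∈xs =
  subst (λ zs → (w , u) ∈ pairs zs) (sym (unfold-reverse x (y ∷ xs))) (snoc uw∈xs)
  where
  snoc : (u , w) ∈ pairs (x ∷ y ∷ xs) → (w , u) ∈ pairs (reverse (y ∷ xs) ++ [ x ])
  snoc (here refl) =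
    subst (λ zs → (y , x) ∈ pairs (zs ++ [ x ])) (sym (unfold-reverse y xs))
          (∈-pairs-∷ʳ-∷ʳ (reverse xs) y x)
  snoc (there uw∈yxs) = ∈-pairs-++⁺ˡ (reverse (y ∷ xs)) [ x ] (∈-pairs-reverse (y ∷ xs) uw∈yxs)

Linked⇒∈pairs : ∀ {R : A → A → Set} {xs u w} → Linked R xs → (u , w) ∈ pairs xs → R u w
Linked⇒∈pairs (Ruw ∷ _)   (here refl)  = Ruw
Linked⇒∈pairs (_   ∷ Rxs) (there uw∈xs) = Linked⇒∈pairs Rxs uw∈xs

∃-successor : ∀ {v} (x : A) xs y → v ∈ x ∷ xs → ∃ λ w → (v , w) ∈ zip (x ∷ xs) (xs ++ [ y ])
∃-successor x []       y (here refl)  = y , here refl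
∃-successor x (z ∷ xs) y (here refl)  = z , here refl
∃-successor x (z ∷ xs) y (there v∈xs) = Product.map₂ there (∃-successor z xs y v∈xs)

∈-zip⁻ˡ : ∀ {xs ys : List A} {u w} → (u , w) ∈ zip xs ys → u ∈ xs
∈-zip⁻ˡ {xs = _ ∷ _} {ys = _ ∷ _} (here refl) = here refl
∈-zip⁻ˡ {xs = _ ∷ _} {ys = _ ∷ _} (there uw∈) = there (∈-zip⁻ˡ uw∈)

∈-zip⁻ʳ : ∀ {xs ys : List A} {u w} → (u , w) ∈ zip xs ys → w ∈ ys
∈-zip⁻ʳ {xs = _ ∷ _} {ys = _ ∷ _} (here refl) = here refl
∈-zip⁻ʳ {xs = _ ∷ _} {ys = _ ∷ _} (there uw∈) = there (∈-zip⁻ʳ uw∈)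

∈-last : ∀ (xs : List A) {y} → last xs ≡ just y → y ∈ xs
∈-last (x ∷ [])     refl = here refl
∈-last (x ∷ y ∷ xs) eq   = there (∈-last (y ∷ xs) eq)

Unique-++⁻ˡ : ∀ xs {ys : List A} → Unique (xs ++ ys) → Unique xs
Unique-++⁻ˡ []       _           = []
Unique-++⁻ˡ (x ∷ xs) (x∉ ∷ uniq) = All.++⁻ˡ xs x∉ ∷ Unique-++⁻ˡ xs uniq

Unique-++⁻ʳ : ∀ xs {ys : List A} → Unique (xs ++ ys) → Unique ys
Unique-++⁻ʳ []       uniq       = uniq
Unique-++⁻ʳ (x ∷ xs) (_ ∷ uniq) = Unique-++⁻ʳ xs uniq

Unique-infix : ∀ xs ys {zs : List A} → Unique (xs ++ ys ++ zs) → Unique ys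
Unique-infix xs ys = Unique-++⁻ˡ ys ∘ Unique-++⁻ʳ xs

Unique-++⇒Disjoint : ∀ xs {ys : List A} → Unique (xs ++ ys) → Disjoint xs ys
Unique-++⇒Disjoint (x ∷ xs) (x∉ ∷ _) (here refl , v∈ys) = All.lookup x∉ (∈-++⁺ʳ xs v∈ys) refl
Unique-++⇒Disjoint (x ∷ xs) (_ ∷ uniq) (there v∈xs , v∈ys) = Unique-++⇒Disjoint xs uniq (v∈xs , v∈ys)

Unique-reverse : ∀ {xs : List A} → Unique xs → Unique (reverse xs)
Unique-reverse {A} {xs} =
  Permutation.Unique-resp-↭ (setoid A)
    (Permutation.↭-sym (setoid A) (Permutation.↭-reverse (setoid A) xs))

no-three-distinct-in-pair : ∀ {a b x y z : A} → x ≡ a ⊎ x ≡ b → y ≡ a ⊎ y ≡ b → z ≡ a ⊎ z ≡ b →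
                            y ≢ x → z ≢ x → z ≢ y → ⊥
no-three-distinct-in-pair (inj₁ refl) (inj₁ refl) _           y≢x _   _   = y≢x refl
no-three-distinct-in-pair (inj₂ refl) (inj₂ refl) _           y≢x _   _   = y≢x refl
no-three-distinct-in-pair (inj₁ refl) (inj₂ refl) (inj₁ refl) _   z≢x _   = z≢x refl
no-three-distinct-in-pair (inj₁ refl) (inj₂ refl) (inj₂ refl) _   _   z≢y = z≢y refl
no-three-distinct-in-pair (inj₂ refl) (inj₁ refl) (inj₁ refl) _   _   z≢y = z≢y refl
no-three-distinct-in-pair (inj₂ refl) (inj₁ refl) (inj₂ refl) _   z≢x _   = z≢x refl

branches-nonempty : ∀ {p₁ q₁ b : A} {P Q P₂ Q₂} P₁ Q₁ → p₁ ≢ q₁ →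
                    p₁ ∷ P ≡ P₁ ++ b ∷ P₂ → q₁ ∷ Q ≡ Q₁ ++ b ∷ Q₂ → 1 ≤ length P₁ + length Q₁
branches-nonempty (_ ∷ _) _       _     _    _    = s≤s z≤n
branches-nonempty []      (_ ∷ _) _     _    _    = s≤s z≤n
branches-nonempty []      []      p₁≢q₁ refl refl = ⊥-elim (p₁≢q₁ refl)

record Detour {A : Set} (p q : List A) : Set where
  field
    prefix     : List A
    fork merge : A
    P₁ P₂ Q₁ Q₂ : List A
    p-split    : p ≡ prefix ++ (fork ∷ P₁ ++ [ merge ]) ++ P₂
    q-split    : q ≡ prefix ++ (fork ∷ Q₁ ++ [ merge ]) ++ Q₂
    disjoint   : Disjoint P₁ Q₁
    nonempty   : 1 ≤ length P₁ + length Q₁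

  branch-p branch-q loop : List A
  branch-p = fork ∷ P₁ ++ [ merge ]
  branch-q = fork ∷ Q₁ ++ [ merge ]
  loop     = fork ∷ P₁ ++ merge ∷ reverse Q₁

module _ {p q : List A} (D : Detour p q) where
  open Detour D

  pairs-closed-loop : pairs (loop ++ [ fork ]) ≡ pairs branch-p ++ pairs (reverse branch-q)
  pairs-closed-loop = begin
    pairs (loop ++ [ fork ])
      ≡⟨ cong (pairs ∘ (fork ∷_)) (++-assoc P₁ (merge ∷ reverse Q₁) [ fork ]) ⟩
    pairs ((fork ∷ P₁) ++ merge ∷ reverse Q₁ ++ [ fork ])
      ≡⟨ pairs-++-∷ (fork ∷ P₁) merge (reverse Q₁ ++ [ fork ]) ⟩
    pairs branch-p ++ pairs (merge ∷ reverse Q₁ ++ [ fork ])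
      ≡⟨ cong (λ zs → pairs branch-p ++ pairs zs) reverse-branch-q ⟨
    pairs branch-p ++ pairs (reverse branch-q)
      ∎
    where
    reverse-branch-q : reverse branch-q ≡ merge ∷ reverse Q₁ ++ [ fork ]
    reverse-branch-q = begin
      reverse branch-q                       ≡⟨ unfold-reverse fork (Q₁ ++ [ merge ]) ⟩
      reverse (Q₁ ++ [ merge ]) ++ [ fork ]  ≡⟨ cong (_++ [ fork ]) (reverse-++ Q₁ [ merge ]) ⟩
      merge ∷ reverse Q₁ ++ [ fork ]         ∎

  closed-loop-pairs⁻ : ∀ {u w} → (u , w) ∈ pairs (loop ++ [ fork ]) →
                       (u , w) ∈ pairs branch-p ⊎ (w , u) ∈ pairs branch-q
  closed-loop-pairs⁻ uw∈loop with ∈-++⁻ (pairs branch-p) (subst (_ ∈_) pairs-closed-loop uw∈loop)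
  ... | inj₁ uw∈p = inj₁ uw∈p
  ... | inj₂ uw∈q = inj₂ (subst (λ zs → _ ∈ pairs zs) (reverse-involutive branch-q)
                                (∈-pairs-reverse (reverse branch-q) uw∈q))

  Neighbours-branch-p⇒loop : ∀ {u w} → Neighbours branch-p u w → Neighbours (loop ++ [ fork ]) u w
  Neighbours-branch-p⇒loop = Sum.map embed embed
    where
    embed : ∀ {e} → e ∈ pairs branch-p → e ∈ pairs (loop ++ [ fork ])
    embed = subst (_ ∈_) (sym pairs-closed-loop) ∘ ∈-++⁺ˡ

  Neighbours-branch-q⇒loop : ∀ {u w} → Neighbours branch-q u w → Neighbours (loop ++ [ fork ]) u w
  Neighbours-branch-q⇒loop = Sum.swap ∘ Sum.map embed embed
    where
    embed : ∀ {u w} → (u , w) ∈ pairs branch-q → (w , u) ∈ pairs (loop ++ [ fork ])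
    embed = subst (_ ∈_) (sym pairs-closed-loop) ∘ ∈-++⁺ʳ (pairs branch-p) ∘ ∈-pairs-reverse branch-q

  pairs-branch-p⊆p : ∀ {e} → e ∈ pairs branch-p → e ∈ pairs p
  pairs-branch-p⊆p = subst (λ r → _ ∈ pairs r) (sym p-split) ∘ ∈-pairs-infix prefix branch-p P₂

  pairs-branch-q⊆q : ∀ {e} → e ∈ pairs branch-q → e ∈ pairs q
  pairs-branch-q⊆q = subst (λ r → _ ∈ pairs r) (sym q-split) ∘ ∈-pairs-infix prefix branch-q Q₂

  loop-length : 3 ≤ length loop
  loop-length = subst (3 ≤_) (sym length-loop) (s≤s (s≤s nonempty))
    where
    length-loop : length loop ≡ 2 + (length P₁ + length Q₁)
    length-loop = cong suc (begin
      length (P₁ ++ merge ∷ reverse Q₁)       ≡⟨ length-++ P₁ ⟩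
      length P₁ + suc (length (reverse Q₁))   ≡⟨ cong (λ k → length P₁ + suc k) (length-reverse Q₁) ⟩
      length P₁ + suc (length Q₁)             ≡⟨ +-suc (length P₁) (length Q₁) ⟩
      suc (length P₁ + length Q₁)             ∎)

  loop-unique : Unique p → Unique q → Unique loop
  loop-unique uniq-p uniq-q = subst Unique loop≡ (Unique.++⁺ uniq-bp (Unique-reverse uniq-Q₁) bp#Q₁)
    where
    uniq-bp : Unique branch-p
    uniq-bp = Unique-infix prefix branch-p (subst Unique p-split uniq-p)
    uniq-bq : Unique branch-q
    uniq-bq = Unique-infix prefix branch-q (subst Unique q-split uniq-q)
    uniq-Q₁ : Unique Q₁
    uniq-Q₁ = Unique-++⁻ˡ Q₁ (Unique-++⁻ʳ [ fork ] uniq-bq)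
    loop≡ : branch-p ++ reverse Q₁ ≡ loop
    loop≡ = cong (fork ∷_) (++-assoc P₁ [ merge ] (reverse Q₁))
    bp#Q₁ : Disjoint branch-p (reverse Q₁)
    bp#Q₁ (v∈bp , v∈rQ₁) with reverse⁻ v∈rQ₁ | v∈bp
    ... | v∈Q₁ | here refl = Unique[x∷xs]⇒x∉xs uniq-bq (∈-++⁺ˡ v∈Q₁)
    ... | v∈Q₁ | there v∈P₁m with ∈-++⁻ P₁ v∈P₁m
    ...   | inj₁ v∈P₁       = disjoint (v∈P₁ , v∈Q₁)
    ...   | inj₂ (here refl) = Unique-++⇒Disjoint Q₁ (Unique-++⁻ʳ [ fork ] uniq-bq) (v∈Q₁ , here refl)

Detour-∷ : ∀ {p q : List A} {u} → Detour p q → Detour (u ∷ p) (u ∷ q)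
Detour-∷ {u = u} D = record
  { prefix = u ∷ prefix ; fork = fork ; merge = merge
  ; P₁ = P₁ ; P₂ = P₂ ; Q₁ = Q₁ ; Q₂ = Q₂
  ; p-split = cong (u ∷_) p-split ; q-split = cong (u ∷_) q-split
  ; disjoint = disjoint ; nonempty = nonempty
  }
  where open Detour D

module _ {A : Set} (_≟_ : DecidableEquality A) where
  open import Data.List.Membership.DecPropositional _≟_ using (_∈?_)

  first-common : ∀ xs ys {y : A} → y ∈ xs → y ∈ ys →
    Σ (List A) λ P₁ → Σ A λ b → Σ (List A) λ P₂ → xs ≡ P₁ ++ b ∷ P₂ × b ∈ ys × Disjoint P₁ ys
  first-common (x ∷ xs) ys y∈xs y∈ys with x ∈? ys
  ... | yes x∈ys = [] , x , xs , refl , x∈ys , λ { (() , _) }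
  ... | no x∉ys with y∈xs
  ...   | here refl = ⊥-elim (x∉ys y∈ys)
  ...   | there y∈xs′ with first-common xs ys y∈xs′ y∈ys
  ...     | P₁ , b , P₂ , refl , b∈ys , P₁#ys = x ∷ P₁ , b , P₂ , refl , b∈ys , x∷P₁#ys
    where
    x∷P₁#ys : Disjoint (x ∷ P₁) ys
    x∷P₁#ys (here refl , x∈ys)   = x∉ys x∈ys
    x∷P₁#ys (there v∈P₁ , v∈ys) = P₁#ys (v∈P₁ , v∈ys)

  detour-at-fork : ∀ {u p₁ q₁ y : A} {P Q} → p₁ ≢ q₁ → y ∈ p₁ ∷ P → y ∈ q₁ ∷ Q →
                   Detour (u ∷ p₁ ∷ P) (u ∷ q₁ ∷ Q)
  detour-at-fork {u} {p₁} {q₁} {_} {P} {Q} p₁≢q₁ y∈P y∈Q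
    with first-common (p₁ ∷ P) (q₁ ∷ Q) y∈P y∈Q
  ... | P₁ , b , P₂ , P-split , b∈Q , P₁#Q with ∈-∃++ b∈Q
  ...   | Q₁ , Q₂ , Q-split = record
    { prefix   = []
    ; fork     = u
    ; merge    = b
    ; P₁ = P₁ ; P₂ = P₂ ; Q₁ = Q₁ ; Q₂ = Q₂
    ; p-split  = cong (u ∷_) (trans P-split (sym (++-assoc P₁ [ b ] P₂)))
    ; q-split  = cong (u ∷_) (trans Q-split (sym (++-assoc Q₁ [ b ] Q₂)))
    ; disjoint = λ (v∈P₁ , v∈Q₁) → P₁#Q (v∈P₁ , subst (_ ∈_) (sym Q-split) (∈-++⁺ˡ v∈Q₁))
    ; nonempty = branches-nonempty P₁ Q₁ p₁≢q₁ P-split Q-split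
    }

  detour : ∀ {x y} (p q : List A) → head p ≡ just x → head q ≡ just x →
           last p ≡ just y → last q ≡ just y → Unique p → Unique q → p ≢ q → Detour p q
  detour (u ∷ []) (.u ∷ []) refl refl _ _ _ _ p≢q = ⊥-elim (p≢q refl)
  detour (u ∷ []) (.u ∷ v ∷ q) refl refl refl last-q _ uniq-q _ =
    ⊥-elim (Unique[x∷xs]⇒x∉xs uniq-q (∈-last (v ∷ q) last-q))
  detour (u ∷ v ∷ p) (.u ∷ []) refl refl last-p refl uniq-p _ _ =
    ⊥-elim (Unique[x∷xs]⇒x∉xs uniq-p (∈-last (v ∷ p) last-p))
  detour (u ∷ p₁ ∷ p) (.u ∷ q₁ ∷ q) refl refl last-p last-q (_ ∷ uniq-p) (_ ∷ uniq-q) p≢q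
    with p₁ ≟ q₁
  ... | no p₁≢q₁ = detour-at-fork p₁≢q₁ (∈-last (p₁ ∷ p) last-p) (∈-last (q₁ ∷ q) last-q)
  ... | yes refl =
    Detour-∷ (detour (p₁ ∷ p) (p₁ ∷ q) refl refl last-p last-q uniq-p uniq-q (p≢q ∘ cong (u ∷_)))

module _ (G : Graph) where
  private
    V : Set
    V = Fin (Graph.n G)

  Adj-sym : ∀ {u v : V} → Adj G u v → Adj G v u
  Adj-sym {u} {v} uv = trans (Graph.sym G v u) uv

  ∈-rotate⁻ : ∀ {v} (c : List V) → v ∈ rotate G c → v ∈ c
  ∈-rotate⁻ (x ∷ xs) v∈rot with ∈-++⁻ xs v∈rot
  ... | inj₁ v∈xs        = there v∈xs
  ... | inj₂ (here refl) = here refl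

  ∈-resp-SameCycle : ∀ {c c' : List V} {v} → SameCycle G c c' → v ∈ c → v ∈ c'
  ∈-resp-SameCycle {x ∷ xs} {c'} same v∈c with ∃-successor x xs x v∈c
  ... | w , vw∈c with Equivalence.to (same _ w) (inj₁ vw∈c)
  ...   | inj₁ vw∈c' = ∈-zip⁻ˡ vw∈c'
  ...   | inj₂ wv∈c' = ∈-rotate⁻ c' (∈-zip⁻ʳ wv∈c')

  Unicyclic⇒SameCycle : Unicyclic G → ∀ {c c'} → IsCycle G c → IsCycle G c' → SameCycle G c c'
  Unicyclic⇒SameCycle (_ , _ , _ , unique) {c} {c'} cyc cyc' u v =
    ⇔.trans (⇔.sym (unique c cyc u v)) (unique c' cyc' u v)

  Neighbours⇒CycleEdge : ∀ (x : V) xs {u w} → Neighbours (x ∷ xs ++ [ x ]) u w →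
                         CycleEdge G (x ∷ xs) u w
  Neighbours⇒CycleEdge x xs = Sum.map on-cycle on-cycle
    where
    on-cycle : ∀ {e} → e ∈ pairs (x ∷ xs ++ [ x ]) → e ∈ zip (x ∷ xs) (xs ++ [ x ])
    on-cycle = subst (_ ∈_) (sym (zip-∷-∷ʳ x xs x))

  IsCycle-intro : ∀ (x : V) xs → 3 ≤ length (x ∷ xs) → Unique (x ∷ xs) →
                  (∀ {u w} → (u , w) ∈ pairs (x ∷ xs ++ [ x ]) → Adj G u w) → IsCycle G (x ∷ xs)
  IsCycle-intro x xs long uniq adjacent =
    long , uniq , subst (All _) (sym (zip-∷-∷ʳ x xs x)) (All.tabulate adjacent)

  detour-IsCycle : ∀ {p q : List V} → Linked (Adj G) p → Linked (Adj G) q → Unique p → Unique q →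
                   (D : Detour p q) → IsCycle G (Detour.loop D)
  detour-IsCycle walk-p walk-q uniq-p uniq-q D =
    IsCycle-intro fork (P₁ ++ merge ∷ reverse Q₁) (loop-length D) (loop-unique D uniq-p uniq-q) adjacent
    where
    open Detour D
    adjacent : ∀ {u w} → (u , w) ∈ pairs (loop ++ [ fork ]) → Adj G u w
    adjacent uw∈loop with closed-loop-pairs⁻ D uw∈loop
    ... | inj₁ uw∈p = Linked⇒∈pairs walk-p (pairs-branch-p⊆p D uw∈p)
    ... | inj₂ wu∈q = Adj-sym (Linked⇒∈pairs walk-q (pairs-branch-q⊆q D wu∈q))

  module _ (m : V → V) where

    Alternating : Bool → List V → Set
    Alternating true  = AltM G m
    Alternating false = AltN G m

    alternating-tail : ∀ s {u v : V} {rs} → Alternating s (u ∷ v ∷ rs) → Alternating (not s) (v ∷ rs)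
    alternating-tail true  = proj₂
    alternating-tail false = proj₂

    alternating-drop : ∀ s pre {u : V} {rs} → Alternating s (pre ++ u ∷ rs) →
                       ∃ λ s' → Alternating s' (u ∷ rs)
    alternating-drop s []            alt = s , alt
    alternating-drop s (x ∷ [])      alt = not s , alternating-tail s alt
    alternating-drop s (x ∷ y ∷ pre) alt = alternating-drop (not s) (y ∷ pre) (alternating-tail s alt)

    first-pair-matched : ∀ {x w : V} X post → AltM G m ((x ∷ X ++ [ w ]) ++ post) →
                         (x , m x) ∈ pairs (x ∷ X ++ [ w ])
    first-pair-matched []      _ (w≡mx , _) = here (cong (_ ,_) (sym w≡mx))
    first-pair-matched (z ∷ X) _ (z≡mx , _) = here (cong (_ ,_) (sym z≡mx))

    IsPegAt-resp-SameCycle : ∀ {c c' v} → SameCycle G c c' → IsPegAt G m c v → IsPegAt G m c' v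
    IsPegAt-resp-SameCycle same (v∈c , off-c) =
      ∈-resp-SameCycle same v∈c , off-c ∘ Equivalence.from (same _ _)

    module _ (inv : ∀ v → m (m v) ≡ v) where

      interior-matched : ∀ s (u : V) X w post {v} → Alternating s ((u ∷ X ++ [ w ]) ++ post) → v ∈ X →
                         Neighbours (u ∷ X ++ [ w ]) v (m v)
      interior-matched true  u (x ∷ X) w post (x≡mu , _) (here refl) =
        inj₂ (here (cong (_, x) (trans (cong m x≡mu) (inv u))))
      interior-matched false u (x ∷ X) w post (_ , alt) (here refl) =
        inj₁ (there (first-pair-matched X post alt))
      interior-matched s u (x ∷ X) w post alt (there v∈X) =
        Sum.map there there (interior-matched (not s) x X w post (alternating-tail s alt) v∈X)

      branch-matched : ∀ {r pre u X w post v} → r ≡ pre ++ (u ∷ X ++ [ w ]) ++ post → AltM G m r →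
                       v ∈ X → Neighbours (u ∷ X ++ [ w ]) v (m v)
      branch-matched {pre = pre} {u} {X} {w} {post} refl alt v∈X
        with s , alt' ← alternating-drop true pre alt = interior-matched s u X w post alt' v∈X

      module _ {p q : List V} (D : Detour p q) where
        open Detour D

        detour-pegs : AltM G m p → AltM G m q → ∀ {v} → IsPegAt G m loop v → v ≡ fork ⊎ v ≡ merge
        detour-pegs alt-p alt-q (here v≡fork , _) = inj₁ v≡fork
        detour-pegs alt-p alt-q (there v∈rest , off-loop) with ∈-++⁻ P₁ v∈rest
        ... | inj₁ v∈P₁ = ⊥-elim (off-loop (Neighbours⇒CycleEdge fork _
                (Neighbours-branch-p⇒loop D (branch-matched p-split alt-p v∈P₁))))
        ... | inj₂ (here v≡merge) = inj₂ v≡merge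
        ... | inj₂ (there v∈rQ₁) = ⊥-elim (off-loop (Neighbours⇒CycleEdge fork _
                (Neighbours-branch-q⇒loop D (branch-matched q-split alt-q (reverse⁻ v∈rQ₁)))))

theorem10 : (G : Graph) → Unicyclic G → Bipartite G →
    (m : Fin (Graph.n G) → Fin (Graph.n G)) → UniquePerfectMatching G m →
    (c : List (Fin (Graph.n G))) → IsCycle G c → MoreThanTwoPegs G m c →
    ∀ x y (p q : List (Fin (Graph.n G))) →
    CoAugmenting G m x y p → CoAugmenting G m x y q → p ≡ q
theorem10 G unicyclic _ m (perfect , _) c cyc
          (a₁ , a₂ , a₃ , peg₁ , peg₂ , peg₃ , (a₂≢a₁ , _) , (a₃≢a₁ , _) , (a₃≢a₂ , _)) x y p q
          (((head-p , last-p , walk-p) , uniq-p) , alt-p) (((head-q , last-q , walk-q) , uniq-q) , alt-q)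
  with ≡-dec _≟_ p q
... | yes p≡q = p≡q
... | no p≢q =
  ⊥-elim (no-three-distinct-in-pair (at-ends peg₁) (at-ends peg₂) (at-ends peg₃) a₂≢a₁ a₃≢a₁ a₃≢a₂)
  where
  D : Detour p q
  D = detour _≟_ p q head-p head-q last-p last-q uniq-p uniq-q p≢q
  same : SameCycle G c (Detour.loop D)
  same = Unicyclic⇒SameCycle G unicyclic cyc (detour-IsCycle G walk-p walk-q uniq-p uniq-q D)
  at-ends : ∀ {v} → IsPegAt G m c v → v ≡ Detour.fork D ⊎ v ≡ Detour.merge D
  at-ends = detour-pegs G m (proj₂ ∘ perfect) D alt-p alt-q ∘ IsPegAt-resp-SameCycle G m same
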